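{- For each non-negative integer $n$, \[ \sum_{k=0}^n (-1)^{k} \binom {n+k}{k} F_{2(n+1)+k} = 1 - \sum_{k=0}^{n-1} (-1)^{k} \binom {2k+1}{k} F_{3(k+2)}, \] \[ \sum_{k=0}^n (-1)^{k} \binom {n+k}{k} L_{2(n+1)+k} = 3 - \sum_{k=0}^{n-1} (-1)^{k} \binom {2k+1}{k} L_{3(k+2)}. \]
   Context: $F_j$ and $L_j$ denote the Fibonacci and Lucas numbers: $F_0=0,F_1=1$, $L_0=2,L_1=1$, both satisfying $X_j=X_{j-1}+X_{j-2}$. -}

module Defs where

open import Data.Nat using (ℕ; zero; suc)
open import Data.Integer using (ℤ; +_; -_; _+_)

fib : ℕ → ℕ
fib 0 = 0
fib 1 = 1
fib (suc (suc j)) = fib (suc j) Data.Nat.+ fib j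

lucas : ℕ → ℕ
lucas 0 = 2
lucas 1 = 1
lucas (suc (suc j)) = lucas (suc j) Data.Nat.+ lucas j

signed : ℕ → ℤ → ℤ
signed zero x = x
signed (suc k) x = - signed k x

sumBelow : ℕ → (ℕ → ℤ) → ℤ
sumBelow zero f = + 0
sumBelow (suc m) f = sumBelow m f + f m

{-# OPTIONS --safe #-}
module Submission where

-- Write S(n, m, X) = Σ_{k≤m} (-1)^k C(n+k, k) X_k. By Pascal's rule
-- S(n+1, m, X) + S(n+1, m, X_{·+1}) telescopes to S(n, m, X) plus one boundary
-- term, so for a sequence with X_{j+2} = X_{j+1} + X_j, shifting X by two
-- while raising n by one costs a single term. For the diagonal sums
-- A_n = S(n, n, X_{2n+2+·}) this gives, with C(2n+2, n+1) = 2 C(2n+1, n),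
--   A_{n+1} = A_n + (-1)^n C(2n+1, n) (X_{3n+3} - 2 X_{3n+5}) = A_n - (-1)^n C(2n+1, n) X_{3n+6},
-- and induction from A_0 = X_2 gives the identity for every such sequence;
-- Fibonacci and Lucas numbers have X_2 = 1 and X_2 = 3.

open import Defs
open import Data.Nat using (ℕ; zero; suc)
import Data.Nat as ℕ
import Data.Nat.Properties as ℕ
open import Data.Nat.Combinatorics using (_C_; nCk+nC[k+1]≡[n+1]C[k+1]; nCk≡nC[n∸k])
import Data.Nat.Tactic.RingSolver as ℕ-Solver
open import Data.Integer using (ℤ; +_; -_; 1ℤ; -1ℤ; _^_; _+_; _-_; _*_)
open import Data.Integer.Properties using (*-identityˡ; +-comm; pos-+; pos-*)
open import Data.Integer.Tactic.RingSolver using (solve-∀)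
open import Data.Product using (_×_; _,_)
open import Function using (_∘_)
open import Relation.Binary.PropositionalEquality
  using (_≡_; refl; sym; trans; cong; cong₂; module ≡-Reasoning)
open ≡-Reasoning

sumBelow-cong : ∀ m {f g : ℕ → ℤ} → (∀ k → f k ≡ g k) → sumBelow m f ≡ sumBelow m g
sumBelow-cong zero    f≗g = refl
sumBelow-cong (suc m) f≗g = cong₂ _+_ (sumBelow-cong m f≗g) (f≗g m)

sumBelow-+ : ∀ m (f g : ℕ → ℤ) →
             sumBelow m (λ k → f k + g k) ≡ sumBelow m f + sumBelow m g
sumBelow-+ zero    f g = refl
sumBelow-+ (suc m) f g = begin
  sumBelow m (λ k → f k + g k) + (f m + g m)    ≡⟨ cong (_+ (f m + g m)) (sumBelow-+ m f g) ⟩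
  (sumBelow m f + sumBelow m g) + (f m + g m)   ≡⟨ medial (sumBelow m f) (sumBelow m g) (f m) (g m) ⟩
  (sumBelow m f + f m) + (sumBelow m g + g m)   ∎
  where
  medial : ∀ a b c d → (a + b) + (c + d) ≡ (a + c) + (b + d)
  medial = solve-∀

signed≡-1^* : ∀ k x → signed k x ≡ -1ℤ ^ k * x
signed≡-1^* zero    x = sym (*-identityˡ x)
signed≡-1^* (suc k) x = trans (cong -_ (signed≡-1^* k x)) (negate (-1ℤ ^ k) x)
  where
  negate : ∀ s x → - (s * x) ≡ (-1ℤ * s) * x
  negate = solve-∀

signed-pos-* : ∀ k a b → signed k (+ (a ℕ.* b)) ≡ -1ℤ ^ k * (+ a * + b)
signed-pos-* k a b = trans (signed≡-1^* k _) (cong (-1ℤ ^ k *_) (pos-* a b))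

signedBinomialSum : ℕ → ℕ → (ℕ → ℤ) → ℤ
signedBinomialSum n m X = sumBelow (suc m) (λ k → -1ℤ ^ k * (+ ((n ℕ.+ k) C k) * X k))

signedBinomialSum-cong : ∀ n m {X Y : ℕ → ℤ} → (∀ k → X k ≡ Y k) →
                         signedBinomialSum n m X ≡ signedBinomialSum n m Y
signedBinomialSum-cong n m X≗Y =
  sumBelow-cong (suc m) (λ k → cong (λ x → -1ℤ ^ k * (+ ((n ℕ.+ k) C k) * x)) (X≗Y k))

signedBinomialSum-+ : ∀ n m (X Y : ℕ → ℤ) →
  signedBinomialSum n m (λ k → X k + Y k) ≡ signedBinomialSum n m X + signedBinomialSum n m Y
signedBinomialSum-+ n m X Y = trans
  (sumBelow-cong (suc m) (λ k → distrib (-1ℤ ^ k) (+ ((n ℕ.+ k) C k)) (X k) (Y k)))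
  (sumBelow-+ (suc m) _ _)
  where
  distrib : ∀ s c x y → s * (c * (x + y)) ≡ s * (c * x) + s * (c * y)
  distrib = solve-∀

pascal : ∀ n k → (suc n ℕ.+ suc k) C suc k ≡ (n ℕ.+ suc k) C suc k ℕ.+ (suc n ℕ.+ k) C k
pascal n k = begin
  suc (n ℕ.+ suc k) C suc k                       ≡⟨ nCk+nC[k+1]≡[n+1]C[k+1] (n ℕ.+ suc k) k ⟨
  (n ℕ.+ suc k) C k ℕ.+ (n ℕ.+ suc k) C suc k     ≡⟨ ℕ.+-comm ((n ℕ.+ suc k) C k) _ ⟩
  (n ℕ.+ suc k) C suc k ℕ.+ (n ℕ.+ suc k) C k     ≡⟨ cong (λ t → (n ℕ.+ suc k) C suc k ℕ.+ t C k) (ℕ.+-suc n k) ⟩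
  (n ℕ.+ suc k) C suc k ℕ.+ (suc n ℕ.+ k) C k     ∎

centralBinomial : ∀ n → (suc n ℕ.+ suc n) C suc n ≡ (suc n ℕ.+ n) C n ℕ.+ (suc n ℕ.+ n) C n
centralBinomial n = begin
  (suc n ℕ.+ suc n) C suc n                       ≡⟨ pascal n n ⟩
  (n ℕ.+ suc n) C suc n ℕ.+ (suc n ℕ.+ n) C n     ≡⟨ cong (ℕ._+ (suc n ℕ.+ n) C n) symmetry ⟩
  (suc n ℕ.+ n) C n ℕ.+ (suc n ℕ.+ n) C n         ∎
  where
  symmetry : (n ℕ.+ suc n) C suc n ≡ (suc n ℕ.+ n) C n
  symmetry = begin
    (n ℕ.+ suc n) C suc n                         ≡⟨ nCk≡nC[n∸k] (ℕ.m≤n+m (suc n) n) ⟩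
    (n ℕ.+ suc n) C ((n ℕ.+ suc n) ℕ.∸ suc n)     ≡⟨ cong₂ _C_ (ℕ.+-suc n n) (ℕ.m+n∸n≡m n (suc n)) ⟩
    (suc n ℕ.+ n) C n                             ∎

signedBinomialSum-pascal : ∀ n m (X : ℕ → ℤ) →
  signedBinomialSum (suc n) m X + signedBinomialSum (suc n) m (X ∘ suc)
    ≡ signedBinomialSum n m X + -1ℤ ^ m * (+ ((suc n ℕ.+ m) C m) * X (suc m))
signedBinomialSum-pascal n zero X = dropZeros (X 0) (X 1)
  where
  dropZeros : ∀ x y → (+ 0 + 1ℤ * (+ 1 * x)) + (+ 0 + 1ℤ * (+ 1 * y)) ≡ (+ 0 + 1ℤ * (+ 1 * x)) + 1ℤ * (+ 1 * y)
  dropZeros = solve-∀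
signedBinomialSum-pascal n (suc m) X =
  pascalStep (signedBinomialSum (suc n) m X) (signedBinomialSum (suc n) m (X ∘ suc)) (signedBinomialSum n m X)
       (-1ℤ ^ m) (X (suc m)) (X (suc (suc m)))
       (+ ((n ℕ.+ suc m) C suc m)) (+ ((suc n ℕ.+ m) C m)) (+ ((suc n ℕ.+ suc m) C suc m))
       (trans (cong +_ (pascal n m)) (pos-+ ((n ℕ.+ suc m) C suc m) ((suc n ℕ.+ m) C m))) (signedBinomialSum-pascal n m X)
  where
  pascalStep : ∀ L₁ L₂ P s x y a b c → c ≡ a + b → L₁ + L₂ ≡ P + s * (b * x) →
         (L₁ + (-1ℤ * s) * (c * x)) + (L₂ + (-1ℤ * s) * (c * y))
           ≡ (P + (-1ℤ * s) * (a * x)) + (-1ℤ * s) * (c * y)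
  pascalStep L₁ L₂ P s x y a b _ refl ih = begin
    (L₁ + (-1ℤ * s) * ((a + b) * x)) + (L₂ + (-1ℤ * s) * ((a + b) * y))
      ≡⟨ regroup L₁ L₂ s a b x y ⟩
    (L₁ + L₂) + (-1ℤ * s) * ((a + b) * x) + (-1ℤ * s) * ((a + b) * y)
      ≡⟨ cong (λ t → t + (-1ℤ * s) * ((a + b) * x) + (-1ℤ * s) * ((a + b) * y)) ih ⟩
    (P + s * (b * x)) + (-1ℤ * s) * ((a + b) * x) + (-1ℤ * s) * ((a + b) * y)
      ≡⟨ cancel P s a b x y ⟩
    (P + (-1ℤ * s) * (a * x)) + (-1ℤ * s) * ((a + b) * y)  ∎
    where
    regroup : ∀ L₁ L₂ s a b x y →
      (L₁ + (-1ℤ * s) * ((a + b) * x)) + (L₂ + (-1ℤ * s) * ((a + b) * y))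
        ≡ (L₁ + L₂) + (-1ℤ * s) * ((a + b) * x) + (-1ℤ * s) * ((a + b) * y)
    regroup = solve-∀
    cancel : ∀ P s a b x y →
      (P + s * (b * x)) + (-1ℤ * s) * ((a + b) * x) + (-1ℤ * s) * ((a + b) * y)
        ≡ (P + (-1ℤ * s) * (a * x)) + (-1ℤ * s) * ((a + b) * y)
    cancel = solve-∀

IsFibonacciLike : (ℕ → ℤ) → Set
IsFibonacciLike X = ∀ j → X (suc (suc j)) ≡ X (suc j) + X j

IsFibonacciLike-drop : ∀ a {X} → IsFibonacciLike X → IsFibonacciLike (λ k → X (a ℕ.+ k))
IsFibonacciLike-drop zero    recurrence = recurrence
IsFibonacciLike-drop (suc a) {X} recurrence = IsFibonacciLike-drop a {X ∘ suc} (recurrence ∘ suc)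

signedBinomialSum-shift₂ : ∀ {X} → IsFibonacciLike X → ∀ n m →
  signedBinomialSum (suc n) m (X ∘ suc ∘ suc)
    ≡ signedBinomialSum n m X + -1ℤ ^ m * (+ ((suc n ℕ.+ m) C m) * X (suc m))
signedBinomialSum-shift₂ {X} recurrence n m = begin
  signedBinomialSum (suc n) m (X ∘ suc ∘ suc)
    ≡⟨ signedBinomialSum-cong (suc n) m (λ k → trans (recurrence k) (+-comm (X (suc k)) (X k))) ⟩
  signedBinomialSum (suc n) m (λ k → X k + X (suc k))
    ≡⟨ signedBinomialSum-+ (suc n) m X (X ∘ suc) ⟩
  signedBinomialSum (suc n) m X + signedBinomialSum (suc n) m (X ∘ suc)
    ≡⟨ signedBinomialSum-pascal n m X ⟩
  signedBinomialSum n m X + -1ℤ ^ m * (+ ((suc n ℕ.+ m) C m) * X (suc m))  ∎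

IsFibonacciLike-step₃ : ∀ {X} → IsFibonacciLike X → ∀ j → X (3 ℕ.+ j) ≡ (X (2 ℕ.+ j) + X (2 ℕ.+ j)) - X j
IsFibonacciLike-step₃ {X} recurrence j = begin
  X (3 ℕ.+ j)                                   ≡⟨ recurrence (suc j) ⟩
  X (2 ℕ.+ j) + X (1 ℕ.+ j)                     ≡⟨ addSub (X (2 ℕ.+ j)) (X (1 ℕ.+ j)) (X j) ⟩
  (X (2 ℕ.+ j) + (X (1 ℕ.+ j) + X j)) - X j     ≡⟨ cong (λ t → (X (2 ℕ.+ j) + t) - X j) (recurrence j) ⟨
  (X (2 ℕ.+ j) + X (2 ℕ.+ j)) - X j             ∎
  where
  addSub : ∀ a b c → a + b ≡ (a + (b + c)) - c
  addSub = solve-∀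

signedBinomialSum-diagonal : ∀ {X} → IsFibonacciLike X → ∀ n →
  signedBinomialSum n n (λ k → X (2 ℕ.* (n ℕ.+ 1) ℕ.+ k))
    ≡ X 2 - sumBelow n (λ k → -1ℤ ^ k * (+ ((2 ℕ.* k ℕ.+ 1) C k) * X (3 ℕ.* (k ℕ.+ 2))))
signedBinomialSum-diagonal {X} recurrence zero = singleTerm (X 2)
  where
  singleTerm : ∀ x → + 0 + 1ℤ * (+ 1 * x) ≡ x - + 0
  singleTerm = solve-∀
signedBinomialSum-diagonal {X} recurrence (suc n) = begin
  signedBinomialSum (suc n) n Y′ + (-1ℤ * s) * (+ e * Y′ (suc n))
    ≡⟨ cong (_+ (-1ℤ * s) * (+ e * Y′ (suc n))) (trans
         (signedBinomialSum-cong (suc n) n (λ k → cong X (shiftIndex n k)))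
         (signedBinomialSum-shift₂ (IsFibonacciLike-drop (2 ℕ.* (n ℕ.+ 1)) {X} recurrence) n n)) ⟩
  (signedBinomialSum n n Y + s * (+ c * X i)) + (-1ℤ * s) * (+ e * Y′ (suc n))
    ≡⟨ cong (λ t → (t + s * (+ c * X i)) + (-1ℤ * s) * (+ e * Y′ (suc n))) (signedBinomialSum-diagonal {X} recurrence n) ⟩
  (X 2 - S + s * (+ c * X i)) + (-1ℤ * s) * (+ e * Y′ (suc n))
    ≡⟨ cong₂ (λ u v → (X 2 - S + s * (+ c * X i)) + (-1ℤ * s) * (u * v))
         (trans (cong +_ (centralBinomial n)) (pos-+ c c)) (cong X (lastIndex n)) ⟩
  (X 2 - S + s * (+ c * X i)) + (-1ℤ * s) * ((+ c + + c) * X (2 ℕ.+ i))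
    ≡⟨ collect (X 2) S s (+ c) (X i) (X (2 ℕ.+ i)) ⟩
  X 2 - (S + s * (+ c * ((X (2 ℕ.+ i) + X (2 ℕ.+ i)) - X i)))
    ≡⟨ cong₂ (λ u t → X 2 - (S + s * (+ (u C n) * t)))
         (upperIndex n) (trans (cong X (tripleIndex n)) (IsFibonacciLike-step₃ {X} recurrence i)) ⟨
  X 2 - (S + s * (+ ((2 ℕ.* n ℕ.+ 1) C n) * X (3 ℕ.* (n ℕ.+ 2))))  ∎
  where
  Y Y′ : ℕ → ℤ
  Y k = X (2 ℕ.* (n ℕ.+ 1) ℕ.+ k)
  Y′ k = X (2 ℕ.* (suc n ℕ.+ 1) ℕ.+ k)
  S s : ℤ
  S = sumBelow n (λ k → -1ℤ ^ k * (+ ((2 ℕ.* k ℕ.+ 1) C k) * X (3 ℕ.* (k ℕ.+ 2))))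
  s = -1ℤ ^ n
  c e i : ℕ
  c = (suc n ℕ.+ n) C n
  e = (suc n ℕ.+ suc n) C suc n
  i = 2 ℕ.* (n ℕ.+ 1) ℕ.+ suc n
  shiftIndex : ∀ n k → 2 ℕ.* (suc n ℕ.+ 1) ℕ.+ k ≡ 2 ℕ.* (n ℕ.+ 1) ℕ.+ (2 ℕ.+ k)
  shiftIndex = ℕ-Solver.solve-∀
  upperIndex : ∀ n → 2 ℕ.* n ℕ.+ 1 ≡ suc n ℕ.+ n
  upperIndex = ℕ-Solver.solve-∀
  lastIndex : ∀ n → 2 ℕ.* (suc n ℕ.+ 1) ℕ.+ suc n ≡ 2 ℕ.+ (2 ℕ.* (n ℕ.+ 1) ℕ.+ suc n)
  lastIndex = ℕ-Solver.solve-∀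
  tripleIndex : ∀ n → 3 ℕ.* (n ℕ.+ 2) ≡ 3 ℕ.+ (2 ℕ.* (n ℕ.+ 1) ℕ.+ suc n)
  tripleIndex = ℕ-Solver.solve-∀
  collect : ∀ x₂ S s d x y →
    (x₂ - S + s * (d * x)) + (-1ℤ * s) * ((d + d) * y) ≡ x₂ - (S + s * (d * ((y + y) - x)))
  collect = solve-∀

signedBinomialSum-diagonal-ℕ : ∀ (X : ℕ → ℕ) → IsFibonacciLike (+_ ∘ X) → ∀ n →
  sumBelow (suc n) (λ k → signed k (+ (((n ℕ.+ k) C k) ℕ.* X (2 ℕ.* (n ℕ.+ 1) ℕ.+ k))))
    ≡ + X 2 - sumBelow n (λ k → signed k (+ (((2 ℕ.* k ℕ.+ 1) C k) ℕ.* X (3 ℕ.* (k ℕ.+ 2)))))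
signedBinomialSum-diagonal-ℕ X recurrence n = begin
  sumBelow (suc n) (λ k → signed k (+ (((n ℕ.+ k) C k) ℕ.* X (2 ℕ.* (n ℕ.+ 1) ℕ.+ k))))
    ≡⟨ sumBelow-cong (suc n) (λ k → signed-pos-* k ((n ℕ.+ k) C k) (X (2 ℕ.* (n ℕ.+ 1) ℕ.+ k))) ⟩
  signedBinomialSum n n (λ k → + X (2 ℕ.* (n ℕ.+ 1) ℕ.+ k))
    ≡⟨ signedBinomialSum-diagonal {+_ ∘ X} recurrence n ⟩
  + X 2 - sumBelow n (λ k → -1ℤ ^ k * (+ ((2 ℕ.* k ℕ.+ 1) C k) * + X (3 ℕ.* (k ℕ.+ 2))))
    ≡⟨ cong (λ t → + X 2 - t) (sumBelow-cong n (λ k → signed-pos-* k ((2 ℕ.* k ℕ.+ 1) C k) (X (3 ℕ.* (k ℕ.+ 2))))) ⟨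
  + X 2 - sumBelow n (λ k → signed k (+ (((2 ℕ.* k ℕ.+ 1) C k) ℕ.* X (3 ℕ.* (k ℕ.+ 2)))))  ∎

theorem17 : (n : ℕ) →
    (sumBelow (suc n) (λ k → signed k (+ (((n Data.Nat.+ k) C k) Data.Nat.* fib (2 Data.Nat.* (n Data.Nat.+ 1) Data.Nat.+ k))))
      ≡ + 1 - sumBelow n (λ k → signed k (+ (((2 Data.Nat.* k Data.Nat.+ 1) C k) Data.Nat.* fib (3 Data.Nat.* (k Data.Nat.+ 2))))))
    × (sumBelow (suc n) (λ k → signed k (+ (((n Data.Nat.+ k) C k) Data.Nat.* lucas (2 Data.Nat.* (n Data.Nat.+ 1) Data.Nat.+ k))))
      ≡ + 3 - sumBelow n (λ k → signed k (+ (((2 Data.Nat.* k Data.Nat.+ 1) C k) Data.Nat.* lucas (3 Data.Nat.* (k Data.Nat.+ 2))))))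
theorem17 n =
  signedBinomialSum-diagonal-ℕ fib (λ j → pos-+ (fib (suc j)) (fib j)) n ,
  signedBinomialSum-diagonal-ℕ lucas (λ j → pos-+ (lucas (suc j)) (lucas j)) n
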